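{- Let $G=(V,E)$ be a finite graph, $k\in\mathbb{N}$, $X,Y$ $k$-heights of $G$ with $X\le Y$ pointwise, and $B\subset V$. Let $D$ be the smallest distributive sublattice of $\Omega_B$ containing $\Omega_{B\mid X}\cup\Omega_{B\mid Y}$. Then $\Omega_{B\mid X}$ is a downset of $D$ and $\Omega_{B\mid Y}$ is an upset of $D$.
   Context: A $k$-height of a graph $H$ is a map $\varphi:V(H)\to\{0,\dots,k\}$ with $|\varphi(v)-\varphi(w)|\le1$ for every edge $\{v,w\}$. $\Omega_B$ is the set of $k$-heights of the induced subgraph $G[B]$, partially ordered pointwise ($\varphi\le\psi$ iff $\varphi(u)\le\psi(u)$ for all $u\in B$); it is a distributive lattice with meet and join the pointwise minimum and maximum. For a $k$-height $X$ of $G$, $\Omega_{B\mid X}=\{\varphi\in\Omega_B:$ the map equal to $\varphi$ on $B$ and to $X$ on $V\setminus B$ is a $k$-height of $G\}$. A downset (upset) of $D$ is a subset $S\subset D$ such that $h\in S$, $g\in D$, $g\le h$ (resp. $g\ge h$) imply $g\in S$. -}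

module Defs where

open import Data.Nat using (ℕ; _≤_; _⊓_; _⊔_; ∣_-_∣)
open import Data.Fin using (Fin)
open import Data.Fin.Subset using (Subset; _∈_)
open import Data.Fin.Subset.Properties using (_∈?_)
open import Relation.Nullary using (¬_; yes; no)
open import Relation.Binary.PropositionalEquality using (_≡_)

record Graph (n : ℕ) : Set₁ where
  field
    Adj    : Fin n → Fin n → Set
    sym    : ∀ {v w} → Adj v w → Adj w v
    irrefl : ∀ {v} → ¬ Adj v v
open Graph public

IsHeight : ∀ {n} → Graph n → ℕ → (Fin n → ℕ) → Set
IsHeight {n} G k X =
  (∀ v → X v ≤ k) × (∀ v w → Adj G v w → ∣ X v - X w ∣ ≤ 1)
  where open import Data.Product using (_×_)

BFun : ∀ {n} → Subset n → Set
BFun {n} B = (v : Fin n) → v ∈ B → ℕ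

-- Ω_B : k-heights of the induced subgraph G[B].
InΩ : ∀ {n} → Graph n → ℕ → (B : Subset n) → BFun B → Set
InΩ {n} G k B φ =
  (∀ v (p : v ∈ B) → φ v p ≤ k) ×
  (∀ v w (p : v ∈ B) (q : w ∈ B) → Adj G v w → ∣ φ v p - φ w q ∣ ≤ 1)
  where open import Data.Product using (_×_)

_≤B_ : ∀ {n} {B : Subset n} → BFun B → BFun B → Set
_≤B_ {n} {B} φ ψ = ∀ v (p : v ∈ B) → φ v p ≤ ψ v p

_∧B_ : ∀ {n} {B : Subset n} → BFun B → BFun B → BFun B
(φ ∧B ψ) v p = φ v p ⊓ ψ v p

_∨B_ : ∀ {n} {B : Subset n} → BFun B → BFun B → BFun B
(φ ∨B ψ) v p = φ v p ⊔ ψ v p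

glue : ∀ {n} (B : Subset n) → BFun B → (Fin n → ℕ) → Fin n → ℕ
glue B φ X v with v ∈? B
... | yes p = φ v p
... | no _  = X v

InΩcond : ∀ {n} → Graph n → ℕ → (B : Subset n) → (Fin n → ℕ) → BFun B → Set
InΩcond {n} G k B X φ = InΩ G k B φ × IsHeight G k (glue B φ X)
  where open import Data.Product using (_×_)

-- D: the sublattice of Ω_B generated by Ω_{B|X} ∪ Ω_{B|Y}, i.e. the
-- smallest subset containing both and closed under pointwise meet and join
-- (any sublattice of the distributive lattice Ω_B is distributive).
data InGen {n} (G : Graph n) (k : ℕ) (B : Subset n) (X Y : Fin n → ℕ)
     : BFun B → Set where
  baseX : ∀ {φ} → InΩcond G k B X φ → InGen G k B X Y φ
  baseY : ∀ {φ} → InΩcond G k B Y φ → InGen G k B X Y φ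
  meet  : ∀ {φ ψ} → InGen G k B X Y φ → InGen G k B X Y ψ → InGen G k B X Y (φ ∧B ψ)
  join  : ∀ {φ ψ} → InGen G k B X Y φ → InGen G k B X Y ψ → InGen G k B X Y (φ ∨B ψ)

IsDownsetOf : ∀ {n} {B : Subset n} → (BFun B → Set) → (BFun B → Set) → Set
IsDownsetOf {B = B} S D = ∀ (g h : BFun B) → S h → D g → g ≤B h → S g

IsUpsetOf : ∀ {n} {B : Subset n} → (BFun B → Set) → (BFun B → Set) → Set
IsUpsetOf {B = B} S D = ∀ (g h : BFun B) → S h → D g → h ≤B g → S g

{-# OPTIONS --safe #-}
-- The map equal to φ ∈ Ω_B on B and to a height Z elsewhere is a height iff,
-- along every edge vw with v ∈ B and w ∉ B, Z w ≤ φ v + 1 and φ v ≤ Z w + 1.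
-- Every element of the lattice generated by Ω_{B|X} ∪ Ω_{B|Y} satisfies the
-- lower constraint for X and the upper one for Y, since X ≤ Y and both
-- constraints survive pointwise min and max.  For g ≤ h with h ∈ Ω_{B|X}, the
-- upper constraint for X passes from h down to g, so g ∈ Ω_{B|X}; dually for Y.
module Submission where

open import Defs
open import Data.Nat using (ℕ; _≤_; zero; suc; s≤s; _⊓_; _⊔_; ∣_-_∣)
open import Data.Nat.Properties
open import Data.Fin using (Fin)
open import Data.Fin.Subset using (Subset; _∈_; _∉_)
open import Data.Fin.Subset.Properties using (_∈?_)
open import Data.Vec.Base using (here; there)
open import Data.Product using (_×_; _,_; proj₁; proj₂)
open import Data.Empty using (⊥-elim)
open import Relation.Nullary using (yes; no)
open import Relation.Binary.PropositionalEquality using (_≡_; refl; cong; subst; subst₂)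

∣-∣≤1⇒≤1+ : ∀ m n → ∣ m - n ∣ ≤ 1 → m ≤ suc n
∣-∣≤1⇒≤1+ m n h = ≤-trans (m≤∣m-n∣+n m n) (+-monoˡ-≤ n h)

∣-∣≤1⇒≤1+′ : ∀ m n → ∣ m - n ∣ ≤ 1 → n ≤ suc m
∣-∣≤1⇒≤1+′ m n h = ∣-∣≤1⇒≤1+ n m (subst (_≤ 1) (∣-∣-comm m n) h)

≤1+⇒∣-∣≤1 : ∀ m n → m ≤ suc n → n ≤ suc m → ∣ m - n ∣ ≤ 1
≤1+⇒∣-∣≤1 zero    n       _           n≤1         = n≤1
≤1+⇒∣-∣≤1 (suc m) zero    m≤1         _           = m≤1
≤1+⇒∣-∣≤1 (suc m) (suc n) (s≤s m≤1+n) (s≤s n≤1+m) = ≤1+⇒∣-∣≤1 m n m≤1+n n≤1+m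

-- suc (m ⊓ n) and suc (m ⊔ n) reduce to suc m ⊓ suc n and suc m ⊔ suc n.
∣⊓-⊓∣≤1 : ∀ a b c d → ∣ a - c ∣ ≤ 1 → ∣ b - d ∣ ≤ 1 → ∣ a ⊓ b - c ⊓ d ∣ ≤ 1
∣⊓-⊓∣≤1 a b c d ac bd = ≤1+⇒∣-∣≤1 (a ⊓ b) (c ⊓ d)
  (⊓-mono-≤ (∣-∣≤1⇒≤1+ a c ac) (∣-∣≤1⇒≤1+ b d bd))
  (⊓-mono-≤ (∣-∣≤1⇒≤1+′ a c ac) (∣-∣≤1⇒≤1+′ b d bd))

∣⊔-⊔∣≤1 : ∀ a b c d → ∣ a - c ∣ ≤ 1 → ∣ b - d ∣ ≤ 1 → ∣ a ⊔ b - c ⊔ d ∣ ≤ 1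
∣⊔-⊔∣≤1 a b c d ac bd = ≤1+⇒∣-∣≤1 (a ⊔ b) (c ⊔ d)
  (⊔-mono-≤ (∣-∣≤1⇒≤1+ a c ac) (∣-∣≤1⇒≤1+ b d bd))
  (⊔-mono-≤ (∣-∣≤1⇒≤1+′ a c ac) (∣-∣≤1⇒≤1+′ b d bd))

∈-irrelevant : ∀ {n} {B : Subset n} {v} (p q : v ∈ B) → p ≡ q
∈-irrelevant here      here      = refl
∈-irrelevant (there p) (there q) = cong there (∈-irrelevant p q)

module _ {n} {B : Subset n} (φ : BFun B) (Z : Fin n → ℕ) where

  glue-∈ : ∀ v (p : v ∈ B) → glue B φ Z v ≡ φ v p
  glue-∈ v p with v ∈? B
  ... | yes p′ = cong (φ v) (∈-irrelevant p′ p)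
  ... | no v∉B = ⊥-elim (v∉B p)

  glue-∉ : ∀ v → v ∉ B → glue B φ Z v ≡ Z v
  glue-∉ v v∉B with v ∈? B
  ... | yes p = ⊥-elim (v∉B p)
  ... | no _  = refl

module HeightsOn {n} (G : Graph n) (k : ℕ) (B : Subset n) where

  InΩ-∧B : ∀ {φ ψ} → InΩ G k B φ → InΩ G k B ψ → InΩ G k B (φ ∧B ψ)
  InΩ-∧B {φ} {ψ} (φ≤k , φ-adj) (_ , ψ-adj) =
    (λ v p → ≤-trans (m⊓n≤m (φ v p) (ψ v p)) (φ≤k v p)) ,
    (λ v w p q vw → ∣⊓-⊓∣≤1 (φ v p) (ψ v p) (φ w q) (ψ w q)
                      (φ-adj v w p q vw) (ψ-adj v w p q vw))

  InΩ-∨B : ∀ {φ ψ} → InΩ G k B φ → InΩ G k B ψ → InΩ G k B (φ ∨B ψ)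
  InΩ-∨B {φ} {ψ} (φ≤k , φ-adj) (ψ≤k , ψ-adj) =
    (λ v p → ⊔-lub (φ≤k v p) (ψ≤k v p)) ,
    (λ v w p q vw → ∣⊔-⊔∣≤1 (φ v p) (ψ v p) (φ w q) (ψ w q)
                      (φ-adj v w p q vw) (ψ-adj v w p q vw))

  BoundedBelowOn∂ : (Fin n → ℕ) → BFun B → Set
  BoundedBelowOn∂ Z φ = ∀ v w (p : v ∈ B) → w ∉ B → Adj G v w → Z w ≤ suc (φ v p)

  BoundedAboveOn∂ : (Fin n → ℕ) → BFun B → Set
  BoundedAboveOn∂ Z φ = ∀ v w (p : v ∈ B) → w ∉ B → Adj G v w → φ v p ≤ suc (Z w)

  BoundedBelowOn∂-monoˡ : ∀ {Z Z′ φ} → (∀ w → Z′ w ≤ Z w) →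
                          BoundedBelowOn∂ Z φ → BoundedBelowOn∂ Z′ φ
  BoundedBelowOn∂-monoˡ Z′≤Z below v w p w∉B vw = ≤-trans (Z′≤Z w) (below v w p w∉B vw)

  BoundedBelowOn∂-monoʳ : ∀ {Z φ ψ} → φ ≤B ψ → BoundedBelowOn∂ Z φ → BoundedBelowOn∂ Z ψ
  BoundedBelowOn∂-monoʳ φ≤ψ below v w p w∉B vw = ≤-trans (below v w p w∉B vw) (s≤s (φ≤ψ v p))

  BoundedAboveOn∂-monoˡ : ∀ {Z Z′ φ} → (∀ w → Z w ≤ Z′ w) →
                          BoundedAboveOn∂ Z φ → BoundedAboveOn∂ Z′ φ
  BoundedAboveOn∂-monoˡ Z≤Z′ above v w p w∉B vw = ≤-trans (above v w p w∉B vw) (s≤s (Z≤Z′ w))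

  BoundedAboveOn∂-monoʳ : ∀ {Z φ ψ} → φ ≤B ψ → BoundedAboveOn∂ Z ψ → BoundedAboveOn∂ Z φ
  BoundedAboveOn∂-monoʳ φ≤ψ above v w p w∉B vw = ≤-trans (φ≤ψ v p) (above v w p w∉B vw)

  BoundedBelowOn∂-∧B : ∀ {Z φ ψ} → BoundedBelowOn∂ Z φ → BoundedBelowOn∂ Z ψ →
                       BoundedBelowOn∂ Z (φ ∧B ψ)
  BoundedBelowOn∂-∧B φ-below ψ-below v w p w∉B vw =
    ⊓-glb (φ-below v w p w∉B vw) (ψ-below v w p w∉B vw)

  BoundedAboveOn∂-∨B : ∀ {Z φ ψ} → BoundedAboveOn∂ Z φ → BoundedAboveOn∂ Z ψ →
                       BoundedAboveOn∂ Z (φ ∨B ψ)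
  BoundedAboveOn∂-∨B φ-above ψ-above v w p w∉B vw =
    ⊔-lub (φ-above v w p w∉B vw) (ψ-above v w p w∉B vw)

  glue-height⇒bounded : ∀ {φ Z} → IsHeight G k (glue B φ Z) →
                        BoundedBelowOn∂ Z φ × BoundedAboveOn∂ Z φ
  glue-height⇒bounded {φ} {Z} (_ , adj) =
    (λ v w p w∉B vw → ∣-∣≤1⇒≤1+′ (φ v p) (Z w) (close v w p w∉B vw)) ,
    (λ v w p w∉B vw → ∣-∣≤1⇒≤1+ (φ v p) (Z w) (close v w p w∉B vw))
    where
    close : ∀ v w (p : v ∈ B) → w ∉ B → Adj G v w → ∣ φ v p - Z w ∣ ≤ 1
    close v w p w∉B vw =
      subst₂ (λ a b → ∣ a - b ∣ ≤ 1) (glue-∈ φ Z v p) (glue-∉ φ Z w w∉B) (adj v w vw)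

  glue-height : ∀ {φ Z} → IsHeight G k Z → InΩ G k B φ →
                BoundedBelowOn∂ Z φ → BoundedAboveOn∂ Z φ → IsHeight G k (glue B φ Z)
  glue-height {φ} {Z} (Z≤k , Z-adj) (φ≤k , φ-adj) below above = glued≤k , glued-adj
    where
    glued≤k : ∀ v → glue B φ Z v ≤ k
    glued≤k v with v ∈? B
    ... | yes p = φ≤k v p
    ... | no _  = Z≤k v

    glued-adj : ∀ v w → Adj G v w → ∣ glue B φ Z v - glue B φ Z w ∣ ≤ 1
    glued-adj v w vw with v ∈? B | w ∈? B
    ... | yes p  | yes q  = φ-adj v w p q vw
    ... | yes p  | no w∉B =
      ≤1+⇒∣-∣≤1 (φ v p) (Z w) (above v w p w∉B vw) (below v w p w∉B vw)
    ... | no v∉B | yes q  =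
      ≤1+⇒∣-∣≤1 (Z v) (φ w q) (below w v q v∉B (sym G vw)) (above w v q v∉B (sym G vw))
    ... | no _   | no _   = Z-adj v w vw

  Sandwiched : (X Y : Fin n → ℕ) → BFun B → Set
  Sandwiched X Y φ = InΩ G k B φ × BoundedBelowOn∂ X φ × BoundedAboveOn∂ Y φ

  InGen⇒Sandwiched : ∀ {X Y φ} → (∀ v → X v ≤ Y v) → InGen G k B X Y φ → Sandwiched X Y φ
  InGen⇒Sandwiched X≤Y (baseX (φ∈Ω , glued)) =
    let below , above = glue-height⇒bounded glued
    in φ∈Ω , below , BoundedAboveOn∂-monoˡ X≤Y above
  InGen⇒Sandwiched X≤Y (baseY (φ∈Ω , glued)) =
    let below , above = glue-height⇒bounded glued
    in φ∈Ω , BoundedBelowOn∂-monoˡ X≤Y below , above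
  InGen⇒Sandwiched X≤Y (meet {φ} {ψ} φ∈D ψ∈D) =
    let φ∈Ω , φ-below , φ-above = InGen⇒Sandwiched X≤Y φ∈D
        ψ∈Ω , ψ-below , _       = InGen⇒Sandwiched X≤Y ψ∈D
    in InΩ-∧B φ∈Ω ψ∈Ω , BoundedBelowOn∂-∧B φ-below ψ-below ,
       BoundedAboveOn∂-monoʳ (λ v p → m⊓n≤m (φ v p) (ψ v p)) φ-above
  InGen⇒Sandwiched X≤Y (join {φ} {ψ} φ∈D ψ∈D) =
    let φ∈Ω , φ-below , φ-above = InGen⇒Sandwiched X≤Y φ∈D
        ψ∈Ω , _       , ψ-above = InGen⇒Sandwiched X≤Y ψ∈D
    in InΩ-∨B φ∈Ω ψ∈Ω , BoundedBelowOn∂-monoʳ (λ v p → m≤m⊔n (φ v p) (ψ v p)) φ-below ,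
       BoundedAboveOn∂-∨B φ-above ψ-above

lemma10 : (n : ℕ) (G : Graph n) (k : ℕ) (X Y : Fin n → ℕ) (B : Subset n) →
          IsHeight G k X → IsHeight G k Y → (∀ v → X v ≤ Y v) →
          IsDownsetOf (InΩcond G k B X) (InGen G k B X Y) ×
          IsUpsetOf (InΩcond G k B Y) (InGen G k B X Y)
lemma10 n G k X Y B X-height Y-height X≤Y = downset , upset
  where
  open HeightsOn G k B

  downset : IsDownsetOf (InΩcond G k B X) (InGen G k B X Y)
  downset g h (_ , h-glued) g∈D g≤h =
    let g∈Ω , g-below , _ = InGen⇒Sandwiched X≤Y g∈D
        g-above = BoundedAboveOn∂-monoʳ g≤h (proj₂ (glue-height⇒bounded h-glued))
    in g∈Ω , glue-height X-height g∈Ω g-below g-above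

  upset : IsUpsetOf (InΩcond G k B Y) (InGen G k B X Y)
  upset g h (_ , h-glued) g∈D h≤g =
    let g∈Ω , _ , g-above = InGen⇒Sandwiched X≤Y g∈D
        g-below = BoundedBelowOn∂-monoʳ h≤g (proj₁ (glue-height⇒bounded h-glued))
    in g∈Ω , glue-height Y-height g∈Ω g-below g-above
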